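{- Let $G=(V,E)$ be an undirected graph with $V=\{0,1,\dots,n-1\}$ and $E$ a symmetric set of ordered pairs. Run the iterative algorithm described in the context starting from $f=\mathrm{id}$. Suppose that in some iteration, producing $f_{\mathit{next}}$ from $f$, the grandparent vector is unchanged, i.e. $f_{\mathit{next}}[f_{\mathit{next}}[u]] = f[f[u]]$ for all $u\in V$. Then every vertex was hooked onto its previous grandparent in that iteration: $f_{\mathit{next}}[u]=f[f[u]]$ for all $u\in V$.
   Context: The algorithm maintains a parent vector $f:V\to V$, initialized by $f[u]=u$ for all $u$. One iteration maps the current vector $f$ to a new vector $f_{\mathit{next}}$ as follows. Start with $f_{\mathit{next}}=f$. (1) For every $(u,v)\in E$, set $f_{\mathit{next}}[f[u]]\leftarrow \min(f_{\mathit{next}}[f[u]],\, f[f[v]])$. (2) For every $(u,v)\in E$, set $f_{\mathit{next}}[u]\leftarrow\min(f_{\mathit{next}}[u],\, f[f[v]])$. (3) For every $u\in V$, set $f_{\mathit{next}}[u]\leftarrow\min(f_{\mathit{next}}[u],\, f[f[u]])$. All right-hand sides read the old vector $f$. Then $f$ is replaced by $f_{\mathit{next}}$ and the next iteration begins. -}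

module Defs where

open import Data.Nat using (ℕ; zero; suc)
open import Data.Fin using (Fin; _≟_)
open import Data.Fin using (toℕ)
open import Data.Nat using (_≤?_)
open import Data.Product using (_×_; _,_)
open import Data.List using (List; foldl; allFin)
open import Data.List.Membership.Propositional using (_∈_)
open import Relation.Nullary using (yes; no)
open import Relation.Binary.PropositionalEquality using (_≡_)

minFin : ∀ {n} → Fin n → Fin n → Fin n
minFin a b with toℕ a ≤? toℕ b
... | yes _ = a
... | no  _ = b

Symmetric : ∀ {n} → List (Fin n × Fin n) → Set
Symmetric E = ∀ u v → (u , v) ∈ E → (v , u) ∈ E

updMin : ∀ {n} → (Fin n → Fin n) → Fin n → Fin n → (Fin n → Fin n)
updMin g i x j with j ≟ i
... | yes _ = minFin (g j) x
... | no  _ = g j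

-- One iteration: all right-hand sides read the old vector f.
step : ∀ {n} → List (Fin n × Fin n) → (Fin n → Fin n) → (Fin n → Fin n)
step {n} E f = phase3 (phase2 (phase1 f))
  where
  phase1 : (Fin n → Fin n) → (Fin n → Fin n)
  phase1 g = foldl (λ h e → let (u , v) = e in updMin h (f u) (f (f v))) g E
  phase2 : (Fin n → Fin n) → (Fin n → Fin n)
  phase2 g = foldl (λ h e → let (u , v) = e in updMin h u (f (f v))) g E
  phase3 : (Fin n → Fin n) → (Fin n → Fin n)
  phase3 g = foldl (λ h u → updMin h u (f (f u))) g (allFin n)

run : ∀ {n} → List (Fin n × Fin n) → ℕ → (Fin n → Fin n)
run E zero = λ u → u
run E (suc k) = step E (run E k)

-- Every coordinate of the parent vector only decreases, and the third phase
-- forces f_next[u] ≤ f[f[u]].  Hence f[f[u]] = f_next[f_next[u]] ≤ f_next[u] ≤ f[f[u]].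
module Submission where

open import Defs
open import Data.Nat using (ℕ; zero; suc)
import Data.Nat as ℕ
import Data.Nat.Properties as ℕ
open import Data.Fin using (Fin; toℕ; _≤_; _≟_)
open import Data.Fin.Properties using (≤-refl; ≤-trans; ≤-antisym)
open import Data.Product using (_×_; proj₁; proj₂)
open import Data.List using (List; []; _∷_; foldl; allFin)
open import Data.List.Membership.Propositional using (_∈_)
open import Data.List.Membership.Propositional.Properties using (∈-allFin)
open import Data.List.Relation.Unary.Any using (here; there)
open import Relation.Nullary using (yes; no; contradiction)
open import Relation.Binary.PropositionalEquality using (_≡_; refl; subst)

private
  variable
    n : ℕ
    A : Set

_≤̇_ : (Fin n → Fin n) → (Fin n → Fin n) → Set
g ≤̇ h = ∀ j → g j ≤ h j

minFin-≤ˡ : (a b : Fin n) → minFin a b ≤ a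
minFin-≤ˡ a b with toℕ a ℕ.≤? toℕ b
... | yes _   = ≤-refl
... | no  a≰b = ℕ.<⇒≤ (ℕ.≰⇒> a≰b)

minFin-≤ʳ : (a b : Fin n) → minFin a b ≤ b
minFin-≤ʳ a b with toℕ a ℕ.≤? toℕ b
... | yes a≤b = a≤b
... | no  _   = ≤-refl

updMin-≤ : (g : Fin n → Fin n) (i x : Fin n) → updMin g i x ≤̇ g
updMin-≤ g i x j with j ≟ i
... | yes _ = minFin-≤ˡ (g j) x
... | no  _ = ≤-refl

updMin-≤-at : (g : Fin n → Fin n) (i x : Fin n) → updMin g i x i ≤ x
updMin-≤-at g i x with i ≟ i
... | yes _   = minFin-≤ʳ (g i) x
... | no  i≢i = contradiction refl i≢i

foldl-updMin-≤ : (i x : A → Fin n) (L : List A) (g : Fin n → Fin n) →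
                 foldl (λ h e → updMin h (i e) (x e)) g L ≤̇ g
foldl-updMin-≤ i x []      g j = ≤-refl
foldl-updMin-≤ i x (e ∷ L) g j =
  ≤-trans (foldl-updMin-≤ i x L (updMin g (i e) (x e)) j) (updMin-≤ g (i e) (x e) j)

foldl-updMin-≤-∈ : (c : Fin n → Fin n) (L : List (Fin n)) (g : Fin n → Fin n) {u : Fin n} →
                   u ∈ L → foldl (λ h w → updMin h w (c w)) g L u ≤ c u
foldl-updMin-≤-∈ c (u ∷ L) g (here refl) =
  ≤-trans (foldl-updMin-≤ (λ w → w) c L (updMin g u (c u)) u) (updMin-≤-at g u (c u))
foldl-updMin-≤-∈ c (w ∷ L) g (there u∈L) = foldl-updMin-≤-∈ c L (updMin g w (c w)) u∈L

step-≤ : (E : List (Fin n × Fin n)) (f : Fin n → Fin n) → step E f ≤̇ f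
step-≤ {n} E f u =
  ≤-trans (foldl-updMin-≤ (λ w → w) (λ w → f (f w)) (allFin n) _ u)
  (≤-trans (foldl-updMin-≤ proj₁ (λ e → f (f (proj₂ e))) E _ u)
           (foldl-updMin-≤ (λ e → f (proj₁ e)) (λ e → f (f (proj₂ e))) E f u))

step-≤-grandparent : (E : List (Fin n × Fin n)) (f : Fin n → Fin n) (u : Fin n) →
                     step E f u ≤ f (f u)
step-≤-grandparent {n} E f u = foldl-updMin-≤-∈ (λ w → f (f w)) (allFin n) _ (∈-allFin u)

run-≤ : (E : List (Fin n × Fin n)) (k : ℕ) → run E k ≤̇ (λ u → u)
run-≤ E zero    u = ≤-refl
run-≤ E (suc k) u = ≤-trans (step-≤ E (run E k) u) (run-≤ E k u)

lemma3 : (n : ℕ) (E : List (Fin n × Fin n)) → Symmetric E → (k : ℕ) →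
         (∀ u → run E (suc k) (run E (suc k) u) ≡ run E k (run E k u)) →
         ∀ u → run E (suc k) u ≡ run E k (run E k u)
lemma3 n E _ k grandparent-unchanged u =
  ≤-antisym (step-≤-grandparent E f u) grandparent-≤-next
  where
  f : Fin n → Fin n
  f = run E k

  grandparent-≤-next : f (f u) ≤ step E f u
  grandparent-≤-next =
    subst (_≤ step E f u) (grandparent-unchanged u) (run-≤ E (suc k) (step E f u))
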